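{- Let $b\ge2$, $u\ge1$, $N\ge0$ be integers and let $U=(U_i)_{i\ge0}$ be a linear numeration system such that $U_{i+u}=bU_i$ for all $i\ge N$. If a set $X\subseteq\mathbb{N}$ is $U$-recognizable, then it is $b$-recognizable. Moreover, given a DFA accepting $\operatorname{rep}_U(X)$, one can compute a DFA accepting $\operatorname{rep}_b(X)$.
   Context: A numeration system is an increasing sequence $U=(U_i)_{i\ge0}$ of integers with $U_0=1$ such that $C_U=\sup_{i}\lceil U_{i+1}/U_i\rceil$ is finite; $A_U=\{0,\ldots,C_U-1\}$. For $n\ge1$, $\operatorname{rep}_U(n)=w_\ell\cdots w_0$ is the unique word over $A_U$ with $n=\sum w_iU_i$, $w_\ell\ne0$ and $\sum_{i=0}^t w_iU_i<U_{t+1}$ for $t=0,\ldots,\ell$ (most significant digit first); $\operatorname{rep}_U(0)$ is the empty word. $X$ is $U$-recognizable if $\operatorname{rep}_U(X)$ is a regular language. A numeration system is linear if it ultimately satisfies a homogeneous linear recurrence with integer coefficients. $\operatorname{rep}_b(n)$ is the usual base-$b$ representation of $n$ over $\{0,\ldots,b-1\}$ without leading zeroes, and $X$ is $b$-recognizable if $\operatorname{rep}_b(X)$ is regular. -}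

module Defs where

open import Data.Nat using (ℕ; zero; suc; _+_; _*_; _∸_; _^_; _≤_; _<_)
open import Data.Nat.DivMod using (_/_)
open import Data.Integer as ℤ using (ℤ; +_)
open import Data.Fin using (Fin; toℕ)
open import Data.List using (List; []; _∷_; length; take; reverse; map; foldl)
open import Data.Bool using (Bool; true)
open import Data.Product using (Σ; _×_; ∃; ∃-syntax)
open import Data.Unit using (⊤)
open import Relation.Binary.PropositionalEquality using (_≡_; _≢_)
open import Function.Bundles using (_⇔_)

-- ⌈ a / d ⌉ (with the harmless convention ⌈ a / 0 ⌉ = 0; never used since U i ≥ 1)
ceilDiv : ℕ → ℕ → ℕ
ceilDiv a zero    = 0
ceilDiv a (suc k) = (a + k) / suc k

sumℤ : (k : ℕ) → (Fin k → ℤ) → ℤ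
sumℤ zero    f = + 0
sumℤ (suc k) f = f Data.Fin.zero ℤ.+ sumℤ k (λ j → f (Data.Fin.suc j))

-- U is a numeration system whose C_U equals C:
-- U 0 = 1, U strictly increasing, and C = sup_i ⌈U(i+1)/U i⌉ (finite, hence attained)
IsNumerationSystem : (ℕ → ℕ) → ℕ → Set
IsNumerationSystem U C =
  (U 0 ≡ 1)
  × (∀ i → U i < U (suc i))
  × (∀ i → ceilDiv (U (suc i)) (U i) ≤ C)
  × (∃[ i ] ceilDiv (U (suc i)) (U i) ≡ C)

IsLinear : (ℕ → ℕ) → Set
IsLinear U =
  ∃[ k ] Σ (Fin k → ℤ) λ a → ∃[ M ] (∀ i → M ≤ i →
      + U (i + k) ≡ sumℤ k (λ j → a j ℤ.* + U (i + toℕ j)))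

-- value of a least-significant-digit-first digit list w.r.t. weights U
valL : (ℕ → ℕ) → List ℕ → ℕ
valL U []       = 0
valL U (d ∷ ds) = d * U 0 + valL (λ i → U (suc i)) ds

NoLeadingZero : ∀ {C} → List (Fin C) → Set
NoLeadingZero []      = ⊤
NoLeadingZero (d ∷ _) = toℕ d ≢ 0

-- w (msd first, over A_U = Fin C) is rep_U(n)
IsRepU : (U : ℕ → ℕ) (C : ℕ) → List (Fin C) → ℕ → Set
IsRepU U C w n =
  let ws = reverse (map toℕ w) in
  (valL U ws ≡ n)
  × NoLeadingZero w
  × (∀ t → t < length ws → valL U (take (suc t) ws) < U (suc t))

IsRepBase : (b : ℕ) → List (Fin b) → ℕ → Set
IsRepBase b w n = (valL (λ i → b ^ i) (reverse (map toℕ w)) ≡ n) × NoLeadingZero w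

record DFA (A : Set) : Set where
  field
    nStates : ℕ
    start   : Fin nStates
    δ       : Fin nStates → A → Fin nStates
    final   : Fin nStates → Bool

-- D accepts the word w (read left to right, i.e. msd first)
Accepts : ∀ {A} → DFA A → List A → Set
Accepts D w = DFA.final D (foldl (DFA.δ D) (DFA.start D) w) ≡ true

Recognizes : ∀ {A} → DFA A → (List A → Set) → Set
Recognizes D L = ∀ w → Accepts D w ⇔ L w

RepU : (U : ℕ → ℕ) (C : ℕ) → (ℕ → Set) → List (Fin C) → Set
RepU U C X w = ∃[ n ] (X n × IsRepU U C w n)

RepBase : (b : ℕ) → (ℕ → Set) → List (Fin b) → Set
RepBase b X w = ∃[ n ] (X n × IsRepBase b w n)

-- rep_U(n) is the greedy expansion of n with leading zeros removed. Put V_i = U_{N+i}; then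
-- V_{i+ku} = b^k V_i, so dividing out b^k shows that the greedy expansion of q b^k + x (x < b^k)
-- along the weights V_{(k+1)u-1}, …, V_0 starts with the u greedy digits of q along
-- V_{u-1}, …, V_0 and continues with the expansion of r b^k + x, where r < V_0 = U_N is the
-- remainder. Reading rep_b(n) from the left with a carry c < U_N, each input digit d therefore
-- releases the next u digits of rep_U(n), namely those of c b + d, and the last N digits are the
-- greedy expansion of the final carry along U_{N-1}, …, U_0. Feeding the released digits to the
-- DFA for rep_U(X), skipping leading zeros, yields a DFA whose states are pairs (carry, state of D).

module Submission where

open import Defs
open import Data.Bool using (Bool; true; false)
open import Data.Empty using (⊥-elim)
open import Data.Fin as Fin using (Fin; toℕ)
open import Data.Fin.Properties using (toℕ-fromℕ<; toℕ<n; toℕ-injective; remQuot-combine)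
open import Data.List using (List; []; _∷_; _++_; _∷ʳ_; length; reverse; take; map; foldl)
open import Data.List.Properties
  using (unfold-reverse; length-reverse; take-all; length-map; map-++; foldl-++)
open import Data.List.Relation.Unary.All using (All; []; _∷_)
open import Data.Maybe using (Maybe; nothing; just; fromMaybe)
open import Data.Nat
open import Data.Nat.Divisibility using (divides-refl)
open import Data.Nat.DivMod
open import Data.Nat.Properties
open import Algebra.Properties.CommutativeSemigroup *-commutativeSemigroup using (x∙yz≈y∙xz)
open import Data.Nat.Tactic.RingSolver using (solve-∀)
open import Data.Product using (Σ; _×_; _,_; proj₁)
open import Data.Sum using (inj₁; inj₂)
open import Data.Unit using (⊤)
open import Function using (_∘_; id)
open import Function.Bundles using (Equivalence; mk⇔)
open import Relation.Binary.PropositionalEquality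

evalMsd : (ℕ → ℕ) → List ℕ → ℕ
evalMsd W []       = 0
evalMsd W (d ∷ ds) = d * W (length ds) + evalMsd W ds

valL-∷ʳ : ∀ W xs d → valL W (xs ∷ʳ d) ≡ valL W xs + d * W (length xs)
valL-∷ʳ W []       d = +-comm (d * W 0) 0
valL-∷ʳ W (x ∷ xs) d =
  trans (cong (x * W 0 +_) (valL-∷ʳ (W ∘ suc) xs d)) (sym (+-assoc (x * W 0) _ _))

valL-reverse : ∀ W ds → valL W (reverse ds) ≡ evalMsd W ds
valL-reverse W []       = refl
valL-reverse W (d ∷ ds) = begin
  valL W (reverse (d ∷ ds))                        ≡⟨ cong (valL W) (unfold-reverse d ds) ⟩
  valL W (reverse ds ∷ʳ d)                         ≡⟨ valL-∷ʳ W (reverse ds) d ⟩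
  valL W (reverse ds) + d * W (length (reverse ds)) ≡⟨ cong₂ (λ v l → v + d * W l) (valL-reverse W ds)
                                                                   (length-reverse ds) ⟩
  evalMsd W ds + d * W (length ds)                 ≡⟨ +-comm (evalMsd W ds) _ ⟩
  evalMsd W (d ∷ ds)                               ∎
  where open ≡-Reasoning

SuffixBounded : (ℕ → ℕ) → List ℕ → Set
SuffixBounded W []            = ⊤
SuffixBounded W ds@(_ ∷ ds′) = evalMsd W ds < W (length ds) × SuffixBounded W ds′

take-++ˡ : ∀ {A : Set} n (xs ys : List A) → n ≤ length xs → take n (xs ++ ys) ≡ take n xs
take-++ˡ zero    xs       ys _         = refl
take-++ˡ (suc n) (x ∷ xs) ys (s≤s n≤) = cong (x ∷_) (take-++ˡ n xs ys n≤)

SuffixBounded⇒valL-take-< : ∀ W ds → SuffixBounded W ds →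
  ∀ t → t < length (reverse ds) → valL W (take (suc t) (reverse ds)) < W (suc t)
SuffixBounded⇒valL-take-< W (d ∷ ds) (top< , bounded) t t<
  with m≤n⇒m<n∨m≡n (s≤s⁻¹ (subst (t <_) (length-reverse (d ∷ ds)) t<))
... | inj₁ t<len = begin-strict
  valL W (take (suc t) (reverse (d ∷ ds))) ≡⟨ cong (valL W ∘ take (suc t)) (unfold-reverse d ds) ⟩
  valL W (take (suc t) (reverse ds ∷ʳ d))  ≡⟨ cong (valL W) (take-++ˡ (suc t) (reverse ds) _ t<len′) ⟩
  valL W (take (suc t) (reverse ds))       <⟨ SuffixBounded⇒valL-take-< W ds bounded t t<len′ ⟩
  W (suc t)                                ∎
  where
  open ≤-Reasoning
  t<len′ : t < length (reverse ds)
  t<len′ = subst (t <_) (sym (length-reverse ds)) t<len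
... | inj₂ refl = begin-strict
  valL W (take (suc t) (reverse (d ∷ ds))) ≡⟨ cong (valL W) (take-all (suc t) (reverse (d ∷ ds))
                                                (≤-reflexive (length-reverse (d ∷ ds)))) ⟩
  valL W (reverse (d ∷ ds))                ≡⟨ valL-reverse W (d ∷ ds) ⟩
  evalMsd W (d ∷ ds)                       <⟨ top< ⟩
  W (suc t)                                ∎
  where open ≤-Reasoning

dropLeadingZeros : ∀ {C} → List (Fin C) → List (Fin C)
dropLeadingZeros []               = []
dropLeadingZeros (Fin.zero  ∷ ds) = dropLeadingZeros ds
dropLeadingZeros (Fin.suc d ∷ ds) = Fin.suc d ∷ ds

noLeadingZero-dropLeadingZeros : ∀ {C} (ds : List (Fin C)) → NoLeadingZero (dropLeadingZeros ds)
noLeadingZero-dropLeadingZeros []               = _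
noLeadingZero-dropLeadingZeros (Fin.zero  ∷ ds) = noLeadingZero-dropLeadingZeros ds
noLeadingZero-dropLeadingZeros (Fin.suc d ∷ ds) = λ ()

evalMsd-dropLeadingZeros : ∀ W {C} (ds : List (Fin C)) →
  evalMsd W (map toℕ (dropLeadingZeros ds)) ≡ evalMsd W (map toℕ ds)
evalMsd-dropLeadingZeros W []               = refl
evalMsd-dropLeadingZeros W (Fin.zero  ∷ ds) = evalMsd-dropLeadingZeros W ds
evalMsd-dropLeadingZeros W (Fin.suc d ∷ ds) = refl

SuffixBounded-dropLeadingZeros : ∀ W {C} (ds : List (Fin C)) →
  SuffixBounded W (map toℕ ds) → SuffixBounded W (map toℕ (dropLeadingZeros ds))
SuffixBounded-dropLeadingZeros W []               _       = _
SuffixBounded-dropLeadingZeros W (Fin.zero  ∷ ds) (_ , b) = SuffixBounded-dropLeadingZeros W ds b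
SuffixBounded-dropLeadingZeros W (Fin.suc d ∷ ds) b       = b

record Weights : Set where
  field
    weight : ℕ → ℕ
    {{weight-nonZero}} : ∀ {i} → NonZero (weight i)
open Weights

shift : ℕ → Weights → Weights
weight (shift p W) i = weight W (i + p)
weight-nonZero (shift p W) {i} = weight-nonZero W {i + p}

greedyDigits : Weights → ℕ → ℕ → List ℕ
greedyDigits W zero    n = []
greedyDigits W (suc p) n = n / weight W p ∷ greedyDigits W p (n % weight W p)

greedyRest : Weights → ℕ → ℕ → ℕ
greedyRest W zero    n = n
greedyRest W (suc p) n = greedyRest W p (n % weight W p)

module _ (W : Weights) where

  length-greedyDigits : ∀ p n → length (greedyDigits W p n) ≡ p
  length-greedyDigits zero    n = refl
  length-greedyDigits (suc p) n = cong suc (length-greedyDigits p _)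

  evalMsd-greedyDigits : ∀ p n → evalMsd (weight W) (greedyDigits W p n) + greedyRest W p n ≡ n
  evalMsd-greedyDigits zero    n = refl
  evalMsd-greedyDigits (suc p) n = begin
    q * weight W (length ds) + evalMsd (weight W) ds + greedyRest W p r
      ≡⟨ cong (λ l → q * weight W l + evalMsd (weight W) ds + greedyRest W p r) (length-greedyDigits p r) ⟩
    q * weight W p + evalMsd (weight W) ds + greedyRest W p r
      ≡⟨ +-assoc (q * weight W p) _ _ ⟩
    q * weight W p + (evalMsd (weight W) ds + greedyRest W p r)
      ≡⟨ cong (q * weight W p +_) (evalMsd-greedyDigits p r) ⟩
    q * weight W p + r
      ≡⟨ +-comm (q * weight W p) r ⟩
    r + q * weight W p
      ≡⟨ m≡m%n+[m/n]*n n (weight W p) ⟨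
    n ∎
    where
    open ≡-Reasoning
    q = n / weight W p
    r = n % weight W p
    ds = greedyDigits W p r

  greedyRest-< : ∀ p n → n < weight W p → greedyRest W p n < weight W 0
  greedyRest-< zero    n n< = n<
  greedyRest-< (suc p) n _  = greedyRest-< p _ (m%n<n n (weight W p))

  greedyRest-<-nonZero : ∀ p n .{{_ : NonZero p}} → greedyRest W p n < weight W 0
  greedyRest-<-nonZero (suc p) n = greedyRest-< p _ (m%n<n n (weight W p))

  greedyDigits-< : ∀ C → (∀ i → weight W (suc i) ≤ C * weight W i) →
    ∀ p n → n < weight W p → All (_< C) (greedyDigits W p n)
  greedyDigits-< C ratio zero    n _  = []
  greedyDigits-< C ratio (suc p) n n< =
    m<n*o⇒m/o<n (<-≤-trans n< (ratio p)) ∷ greedyDigits-< C ratio p _ (m%n<n n (weight W p))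

  greedyDigits-suffixBounded : ∀ p n → n < weight W p → SuffixBounded (weight W) (greedyDigits W p n)
  greedyDigits-suffixBounded zero    n _  = _
  greedyDigits-suffixBounded (suc p) n n< =
    subst (λ l → evalMsd (weight W) ds < weight W l) (sym (cong suc (length-greedyDigits p _)))
      (≤-<-trans (subst (evalMsd (weight W) ds ≤_) (evalMsd-greedyDigits (suc p) n) (m≤m+n _ _)) n<) ,
    greedyDigits-suffixBounded p _ (m%n<n n (weight W p))
    where ds = greedyDigits W (suc p) n

  greedyDigits-+ : ∀ s p n → greedyDigits W (s + p) n ≡
    greedyDigits (shift p W) s n ++ greedyDigits W p (greedyRest (shift p W) s n)
  greedyDigits-+ zero    p n = refl
  greedyDigits-+ (suc s) p n = cong (n / weight W (s + p) ∷_) (greedyDigits-+ s p _)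

  greedyRest-+ : ∀ s p n → greedyRest W (s + p) n ≡ greedyRest W p (greedyRest (shift p W) s n)
  greedyRest-+ zero    p n = refl
  greedyRest-+ (suc s) p n = greedyRest-+ s p _

[m*k+o]/k≡m : ∀ m k {o} .{{_ : NonZero k}} → o < k → (m * k + o) / k ≡ m
[m*k+o]/k≡m m k {o} o<k = begin
  (m * k + o) / k   ≡⟨ +-distrib-/-∣ˡ o (divides-refl m) ⟩
  m * k / k + o / k ≡⟨ cong₂ _+_ (m*n/n≡m m k) (m<n⇒m/n≡0 o<k) ⟩
  m + 0             ≡⟨ +-identityʳ m ⟩
  m                 ∎
  where open ≡-Reasoning

[m*k+o]/[n*k]≡m/n : ∀ m n k {o} .{{_ : NonZero n}} .{{_ : NonZero k}} .{{_ : NonZero (n * k)}} →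
  o < k → (m * k + o) / (n * k) ≡ m / n
[m*k+o]/[n*k]≡m/n m n k {o} o<k = begin
  (m * k + o) / (n * k)     ≡⟨ /-congʳ (*-comm n k) ⟩
  (m * k + o) / (k * n)     ≡⟨ m/n/o≡m/[n*o] (m * k + o) k n ⟨
  (m * k + o) / k / n       ≡⟨ cong (_/ n) ([m*k+o]/k≡m m k o<k) ⟩
  m / n                     ∎
  where
  open ≡-Reasoning
  instance
    k*n≢0 : NonZero (k * n)
    k*n≢0 = m*n≢0 k n

[m*k+o]%[n*k]≡m%n*k+o : ∀ m n k {o} .{{_ : NonZero n}} .{{_ : NonZero (n * k)}} →
  o < k → (m * k + o) % (n * k) ≡ m % n * k + o
[m*k+o]%[n*k]≡m%n*k+o m n k {o} o<k =
  trans ([m*n+o]%[p*n]≡[m*n]%[p*n]+o m n o<k) (cong (_+ o) (sym (m%n*o≡m*o%[n*o] m n k)))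

module _ (W W′ : Weights) (k : ℕ) .{{_ : NonZero k}} (scaled : ∀ i → weight W′ i ≡ weight W i * k) where

  private instance
    weight*k≢0 : ∀ {i} → NonZero (weight W i * k)
    weight*k≢0 {i} = m*n≢0 (weight W i) k

  %-scaled : ∀ p q {o} → o < k → (q * k + o) % weight W′ p ≡ q % weight W p * k + o
  %-scaled p q o<k = trans (%-congʳ (scaled p)) ([m*k+o]%[n*k]≡m%n*k+o q (weight W p) k o<k)

  greedyDigits-scaled : ∀ p q {o} → o < k → greedyDigits W′ p (q * k + o) ≡ greedyDigits W p q
  greedyDigits-scaled zero    q o<k = refl
  greedyDigits-scaled (suc p) q o<k = cong₂ _∷_
    (trans (/-congʳ (scaled p)) ([m*k+o]/[n*k]≡m/n q (weight W p) k o<k))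
    (trans (cong (greedyDigits W′ p) (%-scaled p q o<k)) (greedyDigits-scaled p _ o<k))

  greedyRest-scaled : ∀ p q {o} → o < k → greedyRest W′ p (q * k + o) ≡ greedyRest W p q * k + o
  greedyRest-scaled zero    q o<k = refl
  greedyRest-scaled (suc p) q o<k =
    trans (cong (greedyRest W′ p) (%-scaled p q o<k)) (greedyRest-scaled p _ o<k)

toℕ-mod : ∀ {m} n .{{_ : NonZero n}} → m < n → toℕ (m mod n) ≡ m
toℕ-mod n m<n = trans (toℕ-fromℕ< _) (m<n⇒m%n≡m m<n)

map-toℕ-mod : ∀ C .{{_ : NonZero C}} ds → All (_< C) ds → map toℕ (map (_mod C) ds) ≡ ds
map-toℕ-mod C []       []          = refl
map-toℕ-mod C (d ∷ ds) (d< ∷ ds<) = cong₂ _∷_ (toℕ-mod C d<) (map-toℕ-mod C ds ds<)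

greedyRep : Weights → (C : ℕ) .{{_ : NonZero C}} → ℕ → ℕ → List (Fin C)
greedyRep W C p n = dropLeadingZeros (map (_mod C) (greedyDigits W p n))

greedyRep-IsRepU : ∀ W → weight W 0 ≡ 1 → ∀ C .{{_ : NonZero C}} →
  (∀ i → weight W (suc i) ≤ C * weight W i) →
  ∀ p n → n < weight W p → IsRepU (weight W) C (greedyRep W C p n) n
greedyRep-IsRepU W W0≡1 C ratio p n n< =
  value ,
  noLeadingZero-dropLeadingZeros fs ,
  SuffixBounded⇒valL-take-< (weight W) _ (SuffixBounded-dropLeadingZeros (weight W) fs
    (subst (SuffixBounded (weight W)) (sym toℕ-fs) (greedyDigits-suffixBounded W p n n<)))
  where
  ds = greedyDigits W p n
  fs = map (_mod C) ds
  toℕ-fs : map toℕ fs ≡ ds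
  toℕ-fs = map-toℕ-mod C ds (greedyDigits-< W C ratio p n n<)
  rest≡0 : greedyRest W p n ≡ 0
  rest≡0 = n<1⇒n≡0 (subst (greedyRest W p n <_) W0≡1 (greedyRest-< W p n n<))
  value : valL (weight W) (reverse (map toℕ (dropLeadingZeros fs))) ≡ n
  value = begin
    valL (weight W) (reverse (map toℕ (dropLeadingZeros fs))) ≡⟨ valL-reverse (weight W) (map toℕ (dropLeadingZeros fs)) ⟩
    evalMsd (weight W) (map toℕ (dropLeadingZeros fs))         ≡⟨ evalMsd-dropLeadingZeros (weight W) fs ⟩
    evalMsd (weight W) (map toℕ fs)                            ≡⟨ cong (evalMsd (weight W)) toℕ-fs ⟩
    evalMsd (weight W) ds                                      ≡⟨ +-identityʳ _ ⟨
    evalMsd (weight W) ds + 0                                  ≡⟨ cong (evalMsd (weight W) ds +_) rest≡0 ⟨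
    evalMsd (weight W) ds + greedyRest W p n                   ≡⟨ evalMsd-greedyDigits W p n ⟩
    n                                                          ∎
    where open ≡-Reasoning

module _ {C} (D : DFA (Fin C)) where
  open DFA D

  δ-skipping : Maybe (Fin nStates) → Fin C → Maybe (Fin nStates)
  δ-skipping nothing  Fin.zero = nothing
  δ-skipping nothing  d        = just (δ start d)
  δ-skipping (just s) d        = just (δ s d)

  foldl-δ-skipping-just : ∀ s ds → foldl δ-skipping (just s) ds ≡ just (foldl δ s ds)
  foldl-δ-skipping-just s []       = refl
  foldl-δ-skipping-just s (d ∷ ds) = foldl-δ-skipping-just (δ s d) ds

  foldl-δ-skipping-nothing : ∀ ds →
    fromMaybe start (foldl δ-skipping nothing ds) ≡ foldl δ start (dropLeadingZeros ds)
  foldl-δ-skipping-nothing []               = refl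
  foldl-δ-skipping-nothing (Fin.zero  ∷ ds) = foldl-δ-skipping-nothing ds
  foldl-δ-skipping-nothing (Fin.suc d ∷ ds) =
    cong (fromMaybe start) (foldl-δ-skipping-just (δ start (Fin.suc d)) ds)

module _ {A S : Set} {K : ℕ} (encode : S → Fin K) (decode : Fin K → S)
         (decode-encode : ∀ s → decode (encode s) ≡ s) where

  encodedDFA : S → (S → A → S) → (S → Bool) → DFA A
  encodedDFA s₀ δ accept = record
    { nStates = K ; start = encode s₀ ; δ = λ i a → encode (δ (decode i) a) ; final = accept ∘ decode }

  Accepts-encodedDFA : ∀ s₀ δ accept w → Accepts (encodedDFA s₀ δ accept) w ≡ (accept (foldl δ s₀ w) ≡ true)
  Accepts-encodedDFA s₀ δ accept w =
    cong (λ s → accept s ≡ true) (trans (cong decode (foldl-encode s₀ w)) (decode-encode _))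
    where
    foldl-encode : ∀ s w → foldl (DFA.δ (encodedDFA s₀ δ accept)) (encode s) w ≡ encode (foldl δ s w)
    foldl-encode s []      = refl
    foldl-encode s (a ∷ w) =
      trans (cong (λ s′ → foldl _ (encode (δ s′ a)) w) (decode-encode s)) (foldl-encode (δ s a) w)

mixedRadix-< : ∀ {d b v B} → d < b → v < B → d * B + v < b * B
mixedRadix-< {d} {b} {v} {B} d<b v<B = begin-strict
  d * B + v ≡⟨ +-comm (d * B) v ⟩
  v + d * B <⟨ +-monoˡ-< (d * B) v<B ⟩
  suc d * B ≤⟨ *-monoˡ-≤ B d<b ⟩
  b * B     ∎
  where open ≤-Reasoning

module Construction (b : ℕ) .{{_ : NonZero b}} (U : Weights) (N u : ℕ) .{{_ : NonZero u}}
  (periodic : ∀ j i → weight U (i + j * u + N) ≡ weight U (i + N) * b ^ j)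
  {C : ℕ} .{{_ : NonZero C}} (D : DFA (Fin C)) where

  V : Weights
  V = shift N U

  Carry : Set
  Carry = Fin (weight U N)

  Run : Set
  Run = Maybe (Fin (DFA.nStates D))

  value : List (Fin b) → ℕ
  value w = evalMsd (b ^_) (map toℕ w)

  value-< : ∀ w → value w < b ^ length w
  value-< []      = s≤s z≤n
  value-< (d ∷ w) rewrite length-map toℕ w = mixedRadix-< (toℕ<n d) (value-< w)

  feed : Run → List ℕ → Run
  feed m ds = foldl (δ-skipping D) m (map (_mod C) ds)

  feed-++ : ∀ m ds es → feed m (ds ++ es) ≡ feed (feed m ds) es
  feed-++ m ds es = trans (cong (foldl (δ-skipping D) m) (map-++ (_mod C) ds es))
    (foldl-++ (δ-skipping D) m (map (_mod C) ds) (map (_mod C) es))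

  data State : Set where
    initial dead : State
    reading : Carry → Run → State

  readingFrom : ℕ → ℕ → Run → State
  readingFrom p n m = reading (greedyRest V p n mod weight U N) (feed m (greedyDigits V p n))

  zeroCarry : Carry
  zeroCarry = 0 mod weight U N

  δ : State → Fin b → State
  δ initial       Fin.zero = dead
  δ initial       d        = readingFrom u (toℕ zeroCarry * b + toℕ d) nothing
  δ dead          _        = dead
  δ (reading c m) d        = readingFrom u (toℕ c * b + toℕ d) m

  acceptReading : Carry → Run → Bool
  acceptReading c m = DFA.final D (fromMaybe (DFA.start D) (feed m (greedyDigits U N (toℕ c))))

  accept : State → Bool
  accept initial       = acceptReading zeroCarry nothing
  accept dead          = false
  accept (reading c m) = acceptReading c m

  encode : State → Fin (2 + weight U N * suc (DFA.nStates D))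
  encode initial              = Fin.zero
  encode dead                 = Fin.suc Fin.zero
  encode (reading c nothing)  = Fin.suc (Fin.suc (Fin.combine c Fin.zero))
  encode (reading c (just s)) = Fin.suc (Fin.suc (Fin.combine c (Fin.suc s)))

  decode : Fin (2 + weight U N * suc (DFA.nStates D)) → State
  decode Fin.zero                = initial
  decode (Fin.suc Fin.zero)      = dead
  decode (Fin.suc (Fin.suc i)) with Fin.remQuot (suc (DFA.nStates D)) i
  ... | c , Fin.zero  = reading c nothing
  ... | c , Fin.suc s = reading c (just s)

  decode-encode : ∀ s → decode (encode s) ≡ s
  decode-encode initial = refl
  decode-encode dead    = refl
  decode-encode (reading c nothing)  rewrite remQuot-combine c (Fin.zero {DFA.nStates D}) = refl
  decode-encode (reading c (just s)) rewrite remQuot-combine c (Fin.suc s) = refl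

  dfa : DFA (Fin b)
  dfa = encodedDFA encode decode decode-encode initial δ accept

  carryValue : Carry → List (Fin b) → ℕ
  carryValue c w = toℕ c * b ^ length w + value w

  carryValue-∷ : ∀ c d w → carryValue c (d ∷ w) ≡ (toℕ c * b + toℕ d) * b ^ length w + value w
  carryValue-∷ c d w rewrite length-map toℕ w = regroup (toℕ c) b (toℕ d) (b ^ length w) (value w)
    where
    regroup : ∀ c b d B v → c * (b * B) + (d * B + v) ≡ (c * b + d) * B + v
    regroup = solve-∀

  module _ (j q : ℕ) {x : ℕ} (x<b^j : x < b ^ j) where

    private
      instance
        b^j≢0 : NonZero (b ^ j)
        b^j≢0 = m^n≢0 b j
      scaled : ∀ i → weight (shift (j * u) V) i ≡ weight V i * b ^ j
      scaled = periodic j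

    greedyDigits-block : greedyDigits V (suc j * u) (q * b ^ j + x) ≡
      greedyDigits V u q ++ greedyDigits V (j * u) (greedyRest V u q * b ^ j + x)
    greedyDigits-block = trans (greedyDigits-+ V u (j * u) _) (cong₂ _++_
      (greedyDigits-scaled V _ (b ^ j) scaled u q x<b^j)
      (cong (greedyDigits V (j * u)) (greedyRest-scaled V _ (b ^ j) scaled u q x<b^j)))

    greedyRest-block : greedyRest V (suc j * u) (q * b ^ j + x) ≡
      greedyRest V (j * u) (greedyRest V u q * b ^ j + x)
    greedyRest-block = trans (greedyRest-+ V u (j * u) _)
      (cong (greedyRest V (j * u)) (greedyRest-scaled V _ (b ^ j) scaled u q x<b^j))

    readingFrom-block : ∀ m → readingFrom (suc j * u) (q * b ^ j + x) m ≡
      readingFrom (j * u) (greedyRest V u q * b ^ j + x) (feed m (greedyDigits V u q))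
    readingFrom-block m = cong₂ reading (cong (_mod weight U N) greedyRest-block)
      (trans (cong (feed m) greedyDigits-block) (feed-++ m (greedyDigits V u q) _))

  reading-foldl : ∀ w c m → foldl δ (reading c m) w ≡ readingFrom (length w * u) (carryValue c w) m
  reading-foldl [] c m = cong (λ c′ → reading c′ m) (sym (begin
    (toℕ c * 1 + 0) mod weight U N ≡⟨ cong (_mod weight U N) (trans (+-identityʳ _) (*-identityʳ _)) ⟩
    toℕ c mod weight U N           ≡⟨ toℕ-injective (toℕ-mod _ (toℕ<n c)) ⟩
    c                              ∎))
    where open ≡-Reasoning
  reading-foldl (d ∷ w) c m = begin
    foldl δ (reading c₁ m₁) w                                   ≡⟨ reading-foldl w c₁ m₁ ⟩
    readingFrom (j * u) (toℕ c₁ * b ^ j + value w) m₁            ≡⟨ cong (λ r → readingFrom (j * u) (r * b ^ j + value w) m₁) carry₁ ⟩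
    readingFrom (j * u) (greedyRest V u q * b ^ j + value w) m₁  ≡⟨ readingFrom-block j q (value-< w) m ⟨
    readingFrom (suc j * u) (q * b ^ j + value w) m              ≡⟨ cong (λ n → readingFrom (suc j * u) n m) (carryValue-∷ c d w) ⟨
    readingFrom (length (d ∷ w) * u) (carryValue c (d ∷ w)) m    ∎
    where
    open ≡-Reasoning
    j = length w
    q = toℕ c * b + toℕ d
    c₁ = greedyRest V u q mod weight U N
    m₁ = feed m (greedyDigits V u q)
    carry₁ : toℕ c₁ ≡ greedyRest V u q
    carry₁ = toℕ-mod _ (greedyRest-<-nonZero V u q)

  accept-readingFrom : ∀ p n m → n < weight V p →
    accept (readingFrom p n m) ≡ DFA.final D (fromMaybe (DFA.start D) (feed m (greedyDigits U (p + N) n)))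
  accept-readingFrom p n m n< = cong (DFA.final D ∘ fromMaybe (DFA.start D)) (begin
    feed (feed m (greedyDigits V p n)) (greedyDigits U N (toℕ (greedyRest V p n mod weight U N)))
      ≡⟨ cong (feed (feed m (greedyDigits V p n)) ∘ greedyDigits U N) (toℕ-mod _ (greedyRest-< V p n n<)) ⟩
    feed (feed m (greedyDigits V p n)) (greedyDigits U N (greedyRest V p n))
      ≡⟨ feed-++ m (greedyDigits V p n) _ ⟨
    feed m (greedyDigits V p n ++ greedyDigits U N (greedyRest V p n))
      ≡⟨ cong (feed m) (greedyDigits-+ U p N n) ⟨
    feed m (greedyDigits U (p + N) n) ∎)
    where open ≡-Reasoning

  repU : List (Fin b) → List (Fin C)
  repU w = greedyRep U C (length w * u + N) (value w)

  value-<-weight : ∀ w → value w < weight U (length w * u + N)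
  value-<-weight w = begin-strict
    value w                      <⟨ value-< w ⟩
    b ^ length w                 ≤⟨ m≤n*m (b ^ length w) (weight U N) ⟩
    weight U N * b ^ length w    ≡⟨ periodic (length w) 0 ⟨
    weight U (length w * u + N)  ∎
    where open ≤-Reasoning

  accept-reading-zeroCarry : ∀ w →
    accept (foldl δ (reading zeroCarry nothing) w) ≡ DFA.final D (foldl (DFA.δ D) (DFA.start D) (repU w))
  accept-reading-zeroCarry w = begin
    accept (foldl δ (reading zeroCarry nothing) w)
      ≡⟨ cong accept (reading-foldl w zeroCarry nothing) ⟩
    accept (readingFrom p (toℕ zeroCarry * b ^ length w + value w) nothing)
      ≡⟨ cong (λ c → accept (readingFrom p (c * b ^ length w + value w) nothing)) zeroCarry≡0 ⟩
    accept (readingFrom p (value w) nothing)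
      ≡⟨ accept-readingFrom p (value w) nothing (value-<-weight w) ⟩
    DFA.final D (fromMaybe (DFA.start D) (feed nothing (greedyDigits U (p + N) (value w))))
      ≡⟨ cong (DFA.final D) (foldl-δ-skipping-nothing D (map (_mod C) (greedyDigits U (p + N) (value w)))) ⟩
    DFA.final D (foldl (DFA.δ D) (DFA.start D) (repU w))
      ∎
    where
    open ≡-Reasoning
    p = length w * u
    zeroCarry≡0 : toℕ zeroCarry ≡ 0
    zeroCarry≡0 = toℕ-mod _ (>-nonZero⁻¹ (weight U N))

  accept-initial : ∀ w → NoLeadingZero w → accept (foldl δ initial w) ≡ accept (foldl δ (reading zeroCarry nothing) w)
  accept-initial []               _   = refl
  accept-initial (Fin.zero  ∷ w)  nlz = ⊥-elim (nlz refl)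
  accept-initial (Fin.suc d ∷ w)  _   = refl

  accept-initial⇒noLeadingZero : ∀ w → accept (foldl δ initial w) ≡ true → NoLeadingZero w
  accept-initial⇒noLeadingZero []              _        = _
  accept-initial⇒noLeadingZero (Fin.zero  ∷ w) accepted = ⊥-elim (false≢true (trans (sym (accept-dead w)) accepted))
    where
    accept-dead : ∀ w → accept (foldl δ dead w) ≡ false
    accept-dead []      = refl
    accept-dead (_ ∷ w) = accept-dead w
    false≢true : false ≢ true
    false≢true ()
  accept-initial⇒noLeadingZero (Fin.suc d ∷ w) _        = λ ()

  Accepts-dfa : ∀ w → NoLeadingZero w → Accepts dfa w ≡ Accepts D (repU w)
  Accepts-dfa w nlz = trans (Accepts-encodedDFA encode decode decode-encode initial δ accept w)
    (cong (_≡ true) (trans (accept-initial w nlz) (accept-reading-zeroCarry w)))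

  dfa-recognizes : ∀ X → weight U 0 ≡ 1 → (∀ i → weight U (suc i) ≤ C * weight U i) →
    Recognizes D (RepU (weight U) C X) → Recognizes dfa (RepBase b X)
  dfa-recognizes X U0≡1 ratio recognizes w = mk⇔ to from
    where
    isRepU : IsRepU (weight U) C (repU w) (value w)
    isRepU = greedyRep-IsRepU U U0≡1 C ratio _ _ (value-<-weight w)
    isRepBase : NoLeadingZero w → IsRepBase b w (value w)
    isRepBase nlz = valL-reverse (b ^_) (map toℕ w) , nlz
    represented : RepU (weight U) C X (repU w) → X (value w)
    represented (n , Xn , value≡n , _) = subst X (trans (sym value≡n) (proj₁ isRepU)) Xn
    to : Accepts dfa w → RepBase b X w
    to accepted =
      value w , represented (Equivalence.to (recognizes (repU w)) (subst id (Accepts-dfa w nlz) accepted)) , isRepBase nlz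
      where
      nlz : NoLeadingZero w
      nlz = accept-initial⇒noLeadingZero w
              (subst id (Accepts-encodedDFA encode decode decode-encode initial δ accept w) accepted)
    from : RepBase b X w → Accepts dfa w
    from (n , Xn , value≡n , nlz) = subst id (sym (Accepts-dfa w nlz))
      (Equivalence.from (recognizes (repU w)) (value w , subst X n≡value Xn , isRepU))
      where
      n≡value : n ≡ value w
      n≡value = trans (sym value≡n) (valL-reverse (b ^_) (map toℕ w))

m≤ceilDiv[m,n]*n : ∀ m n .{{_ : NonZero n}} → m ≤ ceilDiv m n * n
m≤ceilDiv[m,n]*n m n@(suc k) = +-cancelʳ-≤ k m (q * n) (begin
  m + k                 ≡⟨ m≡m%n+[m/n]*n (m + k) n ⟩
  (m + k) % n + q * n   ≤⟨ +-monoˡ-≤ (q * n) (s≤s⁻¹ (m%n<n (m + k) n)) ⟩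
  k + q * n             ≡⟨ +-comm k (q * n) ⟩
  q * n + k             ∎)
  where
  open ≤-Reasoning
  q = (m + k) / n

increasing-positive : ∀ (U : ℕ → ℕ) → U 0 ≡ 1 → (∀ i → U i < U (suc i)) → ∀ i → 0 < U i
increasing-positive U U0≡1 increasing zero    = subst (0 <_) (sym U0≡1) z<s
increasing-positive U U0≡1 increasing (suc i) = <-trans (increasing-positive U U0≡1 increasing i) (increasing i)

periodic-iterate : ∀ (U : ℕ → ℕ) b u N → (∀ i → N ≤ i → U (i + u) ≡ b * U i) →
  ∀ j i → U (i + j * u + N) ≡ U (i + N) * b ^ j
periodic-iterate U b u N period zero    i = trans (cong (λ k → U (k + N)) (+-identityʳ i)) (sym (*-identityʳ _))
periodic-iterate U b u N period (suc j) i = begin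
  U (i + (u + j * u) + N)  ≡⟨ cong U (reassoc i u (j * u) N) ⟩
  U (i + j * u + N + u)    ≡⟨ period _ (m≤n+m N (i + j * u)) ⟩
  b * U (i + j * u + N)    ≡⟨ cong (b *_) (periodic-iterate U b u N period j i) ⟩
  b * (U (i + N) * b ^ j)  ≡⟨ x∙yz≈y∙xz b (U (i + N)) (b ^ j) ⟩
  U (i + N) * (b * b ^ j)  ∎
  where
  open ≡-Reasoning
  reassoc : ∀ i u v N → i + (u + v) + N ≡ i + v + N + u
  reassoc = solve-∀

proposition7p2 : (b u N : ℕ) → 2 ≤ b → 1 ≤ u →
    (U : ℕ → ℕ) (C : ℕ) → IsNumerationSystem U C → IsLinear U →
    (∀ i → N ≤ i → U (i + u) ≡ b * U i) →
    Σ (DFA (Fin C) → DFA (Fin b)) λ f →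
      (X : ℕ → Set) (D : DFA (Fin C)) →
      Recognizes D (RepU U C X) → Recognizes (f D) (RepBase b X)
proposition7p2 b u N 2≤b 1≤u U C (U0≡1 , increasing , ceilDiv≤C , _) _ period =
  dfa , λ X D → dfa-recognizes D X U0≡1 ratio
  where
  positive : ∀ i → 0 < U i
  positive = increasing-positive U U0≡1 increasing
  W : Weights
  W = record { weight = U ; weight-nonZero = λ {i} → >-nonZero (positive i) }
  ratio : ∀ i → U (suc i) ≤ C * U i
  ratio i = ≤-trans (m≤ceilDiv[m,n]*n (U (suc i)) (U i) {{>-nonZero (positive i)}})
                    (*-monoˡ-≤ (U i) (ceilDiv≤C i))
  instance
    b≢0 : NonZero b
    b≢0 = >-nonZero (<-trans z<s 2≤b)
    u≢0 : NonZero u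
    u≢0 = >-nonZero 1≤u
    C≢0 : NonZero C
    C≢0 = m*n≢0⇒m≢0 C {{>-nonZero (<-≤-trans (positive 1) (ratio 0))}}
  open Construction b W N u (periodic-iterate U b u N period)
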